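{- For all integers $m,n\ge 1$, the number of maximal spotlight tilings of the $m\times n$ rectangle is $\binom{m+n-2}{m-1}$.
   Context: A region is a finite set of unit squares of the square grid whose edge-adjacency graph is connected. A northwest corner of a region $R$ is a square of $R$ such that neither the square directly above it nor the square directly to its left belongs to $R$. A spotlight tiling of $R$ is produced recursively: choose a northwest corner $s$ of $R$ and place a spotlight with endpoint $s$, extending either east (horizontally) or south (vertically) as far as possible, i.e. consisting of $s$ together with the maximal run of consecutive squares of $R$ in that direction. The uncovered squares form a disjoint union of regions (connected components), each of which is then given a spotlight tiling recursively; the empty region has exactly one (empty) tiling. The spotlight tiling is the final collection of spotlights, a partition of $R$ into segments. Two spotlight tilings are the same if and only if they give the same collection of spotlights (order of placement is irrelevant, and a last-placed spotlight of length $1$ carries no direction). A spotlight tiling of the $m\times n$ rectangle is maximal if it uses the largest number of spotlights among all spotlight tilings of that rectangle. -}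

module Defs where

open import Data.Nat using (ℕ; zero; suc; _+_; _≤_; _<_)
open import Data.Product using (Σ; ∃; _×_; _,_; proj₁; proj₂)
open import Data.Sum using (_⊎_)
open import Data.List using (List; []; _∷_; length)
open import Data.List.Membership.Propositional using (_∈_)
open import Data.List.Relation.Unary.Unique.Propositional using (Unique)
open import Relation.Nullary using (¬_)
open import Relation.Binary.PropositionalEquality using (_≡_)

-- A square of the grid: (row , column); rows increase downward (south),
-- columns increase to the right (east).
Cell : Set
Cell = ℕ × ℕ

row col : Cell → ℕ
row = proj₁
col = proj₂

Cells : Set₁
Cells = Cell → Set

Adj : Cell → Cell → Set
Adj (i , j) (i' , j') =
  (i ≡ i' × (suc j ≡ j' ⊎ suc j' ≡ j)) ⊎ (j ≡ j' × (suc i ≡ i' ⊎ suc i' ≡ i))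

data Conn (U : Cells) (a : Cell) : Cell → Set where
  here : U a → Conn U a a
  next : ∀ {b c} → Conn U a b → Adj b c → U c → Conn U a c

-- The connected component of U containing a (meaningful when U a).
Component : Cells → Cell → Cells
Component U a = Conn U a

NW : Cells → Cell → Set
NW R (i , j) = R (i , j)
             × (∀ i' → suc i' ≡ i → ¬ R (i' , j))
             × (∀ j' → suc j' ≡ j → ¬ R (i , j'))

-- A segment (spotlight) determined by its first (northwest) square and its
-- last square; a horizontal segment has equal rows, a vertical one equal
-- columns; a segment of length 1 has equal endpoints (no direction).
record Seg : Set where
  constructor seg
  field
    start : Cell
    end   : Cell

-- Square c belongs to the segment (the bounding box of a line segment).
InSeg : Cell → Seg → Set
InSeg c (seg (i , j) (i' , j')) =
  (i ≤ row c × row c ≤ i') × (j ≤ col c × col c ≤ j')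

MaxSpot : Cells → Cell → Cell → Set
MaxSpot R (i , j) e =
    (Σ ℕ λ k → e ≡ (i , j + k)
             × (∀ t → t ≤ k → R (i , j + t))
             × ¬ R (i , suc (j + k)))
  ⊎ (Σ ℕ λ k → e ≡ (i + k , j)
             × (∀ t → t ≤ k → R (i + t , j))
             × ¬ R (suc (i + k) , j))

Rem : Cells → Cell → Cell → Cells
Rem R s e c = R c × ¬ InSeg c (seg s e)

_≋_ : List Seg → List Seg → Set
T ≋ T' = ∀ t → (t ∈ T → t ∈ T') × (t ∈ T' → t ∈ T)

-- After placing the spotlight
-- seg s e, each connected component of the uncovered set U receives a
-- spotlight tiling f a ua (indexed by a square a of the component; squares of
-- the same component receive the same tiling), and the rest of the tiling
-- is the union of these.
data Tiles : Cells → List Seg → Set₁ where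
  empty : ∀ {R} → (∀ c → ¬ R c) → Tiles R []
  step  : ∀ {R T'} (s e : Cell) → NW R s → MaxSpot R s e →
          (f : (a : Cell) → Rem R s e a → List Seg) →
          (∀ a ua → Tiles (Component (Rem R s e) a) (f a ua)) →
          (∀ a b ua ub → Conn (Rem R s e) a b → f a ua ≋ f b ub) →
          (∀ t → (t ∈ T' → Σ Cell λ a → Σ (Rem R s e a) λ ua → t ∈ f a ua)
               × (∀ a ua → t ∈ f a ua → t ∈ T')) →
          Unique T' →
          Tiles R (seg s e ∷ T')

Rect : ℕ → ℕ → Cells
Rect m n (i , j) = i < m × j < n

MaxTiling : ℕ → ℕ → List Seg → Set₁
MaxTiling m n T = Tiles (Rect m n) T
                × (∀ T' → Tiles (Rect m n) T' → length T' ≤ length T)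

module Submission where

-- In a box (a rectangle of squares) the only northwest corner is the top left
-- square, and a maximal spotlight from it covers either the whole top row or
-- the whole left column; the uncovered squares form again a box, one row
-- shorter or one column narrower.  Hence every spotlight tiling of an
-- (m+1)×(n+1) box peels off rows and columns one at a time and has at most
-- m+n+1 spotlights; it has exactly m+n+1 precisely when the box shrinks to
-- a single square before its last spotlight, i.e. when the removals of rows
-- and columns follow a lattice path from (m , n) to (0 , 0).  There are
-- (m+n choose m) such paths.

open import Defs
open import Data.Nat using (ℕ; zero; suc; _+_; _∸_; _≤_; _<_; z≤n; s≤s; z<s)
open import Data.Nat.Properties
open import Data.Nat.Combinatorics using (_C_; nCn≡1; nCk+nC[k+1]≡[n+1]C[k+1])
open import Data.Product using (Σ; _×_; _,_; proj₁; proj₂)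
open import Data.Sum using (_⊎_; inj₁; inj₂)
open import Data.Empty using (⊥; ⊥-elim)
open import Data.List using (List; []; _∷_; length; map; _++_)
open import Data.List.Properties using (length-map; length-++; length-removeAt′; ∷-injectiveˡ; ∷-injectiveʳ)
open import Data.List.Relation.Unary.All as All using (All)
open import Data.List.Relation.Unary.Any as Any using (Any; here; there)
open import Data.List.Relation.Unary.AllPairs as AllPairs using (AllPairs)
open import Data.List.Relation.Unary.Unique.Propositional using (Unique)
import Data.List.Relation.Unary.Unique.Propositional.Properties as Unique
open import Data.List.Membership.Propositional using (_∈_; _∉_)
open import Data.List.Membership.Propositional.Properties
  using (∈-map⁺; ∈-map⁻; ∈-++⁺ˡ; ∈-++⁺ʳ; ∈-++⁻)
open import Relation.Nullary using (¬_)
open import Relation.Binary.PropositionalEquality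
  using (_≡_; _≢_; refl; sym; trans; cong; cong₂; subst; module ≡-Reasoning)

-- Extensional equality of sets of squares.  A region is only known up to ≐
-- after a spotlight is removed, so all box lemmas are stated up to ≐.
_≐_ : Cells → Cells → Set
R ≐ S = ∀ c → (R c → S c) × (S c → R c)

Box : ℕ → ℕ → ℕ → ℕ → Cells
Box a b m n (i , j) = (a ≤ i × i < a + m) × (b ≤ j × j < b + n)

rect≐box : ∀ m n → Rect m n ≐ Box 0 0 m n
rect≐box m n (i , j) =
  (λ { (i<m , j<n) → (z≤n , i<m) , (z≤n , j<n) }) ,
  (λ { ((_ , i<m) , (_ , j<n)) → i<m , j<n })

box-offset : ∀ {a b m n p q} → p < m → q < n → Box a b m n (a + p , b + q)
box-offset {a} {b} {p = p} {q} p<m q<n =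
  (m≤m+n a p , +-monoʳ-< a p<m) , (m≤m+n b q , +-monoʳ-< b q<n)

box-corner : ∀ a b m n → Box a b (suc m) (suc n) (a , b)
box-corner a b m n = (≤-refl , m<m+n a z<s) , (≤-refl , m<m+n b z<s)

box-no-rows : ∀ {a b n c} → ¬ Box a b 0 n c
box-no-rows {a} ((a≤i , i<a+0) , _) = <⇒≱ (subst (_ <_) (+-identityʳ a) i<a+0) a≤i

box-no-cols : ∀ {a b m c} → ¬ Box a b m 0 c
box-no-cols {b = b} (_ , (b≤j , j<b+0)) = <⇒≱ (subst (_ <_) (+-identityʳ b) j<b+0) b≤j

conn-end : ∀ {U a b} → Conn U a b → U b
conn-end (here u)     = u
conn-end (next _ _ u) = u

conn-mono : ∀ {U V : Cells} → (∀ c → U c → V c) → ∀ {a b} → Conn U a b → Conn V a b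
conn-mono U⊆V (here u)        = here (U⊆V _ u)
conn-mono U⊆V (next p adj u)  = next (conn-mono U⊆V p) adj (U⊆V _ u)

conn-trans : ∀ {U a b c} → Conn U a b → Conn U b c → Conn U a c
conn-trans p (here _)       = p
conn-trans p (next q adj u) = next (conn-trans p q) adj u

adj-sym : ∀ {x y} → Adj x y → Adj y x
adj-sym (inj₁ (e , inj₁ p)) = inj₁ (sym e , inj₂ p)
adj-sym (inj₁ (e , inj₂ p)) = inj₁ (sym e , inj₁ p)
adj-sym (inj₂ (e , inj₁ p)) = inj₂ (sym e , inj₂ p)
adj-sym (inj₂ (e , inj₂ p)) = inj₂ (sym e , inj₁ p)

conn-sym : ∀ {U a b} → Conn U a b → Conn U b a
conn-sym (here u)       = here u
conn-sym (next p adj u) = conn-trans (next (here u) (adj-sym adj) (conn-end p)) (conn-sym p)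

box-path : ∀ a b m n p q → p < m → q < n → Conn (Box a b m n) (a , b) (a + p , b + q)
box-path a b m n zero zero p<m q<n =
  subst (λ x → Conn (Box a b m n) x (a + 0 , b + 0))
        (cong₂ _,_ (+-identityʳ a) (+-identityʳ b))
        (here (box-offset p<m q<n))
box-path a b m n (suc p) zero p<m q<n =
  next (box-path a b m n p zero (<-trans (n<1+n p) p<m) q<n)
       (inj₂ (refl , inj₁ (sym (+-suc a p))))
       (box-offset p<m q<n)
box-path a b m n p (suc q) p<m q<n =
  next (box-path a b m n p q p<m (<-trans (n<1+n q) q<n))
       (inj₁ (refl , inj₁ (sym (+-suc b q))))
       (box-offset p<m q<n)

box-connected : ∀ {a b m n} c → Box a b m n c → Conn (Box a b m n) (a , b) c
box-connected {a} {b} {m} {n} (i , j) ((a≤i , i<) , (b≤j , j<)) =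
  subst (Conn (Box a b m n) (a , b)) (cong₂ _,_ (m+[n∸m]≡n a≤i) (m+[n∸m]≡n b≤j))
    (box-path a b m n (i ∸ a) (j ∸ b) (offset a≤i i<) (offset b≤j j<))
  where
  offset : ∀ {x y k} → x ≤ y → y < x + k → y ∸ x < k
  offset {x} {y} {k} x≤y y<x+k =
    +-cancelˡ-< x (y ∸ x) k (subst (_< x + k) (sym (m+[n∸m]≡n x≤y)) y<x+k)

≐box-connected : ∀ {U a b m n x y} → U ≐ Box a b m n → U x → U y → Conn U x y
≐box-connected {x = x} {y} U≐ ux uy =
  conn-mono (λ c → proj₂ (U≐ c))
    (conn-trans (conn-sym (box-connected x (proj₁ (U≐ x) ux)))
                (box-connected y (proj₁ (U≐ y) uy)))

component-of-box : ∀ {U a b m n x} → U ≐ Box a b m n → U x → Component U x ≐ Box a b m n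
component-of-box U≐ ux c =
  (λ p → proj₁ (U≐ c) (conn-end p)) , (λ bc → ≐box-connected U≐ ux (proj₂ (U≐ c) bc))

topRow : ℕ → ℕ → ℕ → Seg
topRow a b n = seg (a , b) (a , b + n)

leftCol : ℕ → ℕ → ℕ → Seg
leftCol a b m = seg (a , b) (a + m , b)

topRow≢leftCol : ∀ {a b m n} → topRow a b (suc n) ≢ leftCol a b (suc m)
topRow≢leftCol {a} {m = m} eq =
  <-irrefl (cong (λ s → row (Seg.end s)) eq) (m<m+n a (z<s {m}))

box-nw : ∀ {R a b m n} → R ≐ Box a b (suc m) (suc n) → NW R (a , b)
box-nw {a = a} {b} {m} {n} R≐ =
  proj₂ (R≐ _) (box-corner a b m n) ,
  (λ { _ refl r → <-irrefl refl (proj₁ (proj₁ (proj₁ (R≐ _) r))) }) ,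
  (λ { _ refl r → <-irrefl refl (proj₁ (proj₂ (proj₁ (R≐ _) r))) })

box-nw-unique : ∀ {R a b m n s} → R ≐ Box a b m n → NW R s → s ≡ (a , b)
box-nw-unique {R} {a} {b} {s = i , j} R≐ (r , up , left)
  with proj₁ (R≐ _) r
... | ((a≤i , i<) , (b≤j , j<)) with m≤n⇒m<n∨m≡n a≤i | m≤n⇒m<n∨m≡n b≤j
... | inj₁ (s≤s {n = i'} a≤i') | _ =
  ⊥-elim (up i' refl (proj₂ (R≐ _) ((a≤i' , <-trans (n<1+n i') i<) , (b≤j , j<))))
... | inj₂ refl | inj₁ (s≤s {n = j'} b≤j') =
  ⊥-elim (left j' refl (proj₂ (R≐ _) ((a≤i , i<) , (b≤j' , <-trans (n<1+n j') j<))))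
... | inj₂ refl | inj₂ refl = refl

row-spot : ∀ {R a b m n} → R ≐ Box a b (suc m) (suc n) → MaxSpot R (a , b) (a , b + n)
row-spot {a = a} {b} {m} {n} R≐ = inj₁ (n , refl ,
  (λ t t≤n → proj₂ (R≐ _) (proj₁ (box-corner a b m n) , (m≤m+n b t , +-monoʳ-< b (s≤s t≤n)))) ,
  (λ r → <-irrefl (sym (+-suc b n)) (proj₂ (proj₂ (proj₁ (R≐ _) r)))))

col-spot : ∀ {R a b m n} → R ≐ Box a b (suc m) (suc n) → MaxSpot R (a , b) (a + m , b)
col-spot {a = a} {b} {m} {n} R≐ = inj₂ (m , refl ,
  (λ t t≤m → proj₂ (R≐ _) ((m≤m+n a t , +-monoʳ-< a (s≤s t≤m)) , proj₂ (box-corner a b m n))) ,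
  (λ r → <-irrefl (sym (+-suc a m)) (proj₂ (proj₁ (proj₁ (R≐ _) r)))))

maximal-run : ∀ b k n → b + k < b + suc n → ¬ (suc (b + k) < b + suc n) → k ≡ n
maximal-run b k n inside stop =
  ≤-antisym (≤-pred (+-cancelˡ-< b k (suc n) inside))
            (≮⇒≥ λ k<n → stop (subst (_< b + suc n) (+-suc b k) (+-monoʳ-< b (s≤s k<n))))

box-spotlight : ∀ {R a b m n e} → R ≐ Box a b (suc m) (suc n) → MaxSpot R (a , b) e →
                e ≡ (a , b + n) ⊎ e ≡ (a + m , b)
box-spotlight {a = a} {b} {m} {n} R≐ (inj₁ (k , refl , run , stop)) =
  inj₁ (cong (λ k → (a , b + k)) (maximal-run b k n j< (λ j+1< → stop (proj₂ (R≐ _)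
    (rowOk , (≤-trans (m≤m+n b k) (n≤1+n _) , j+1<))))))
  where
  rowOk = proj₁ (proj₁ (R≐ _) (run k ≤-refl))
  j< = proj₂ (proj₂ (proj₁ (R≐ _) (run k ≤-refl)))
box-spotlight {a = a} {b} {m} {n} R≐ (inj₂ (k , refl , run , stop)) =
  inj₂ (cong (λ k → (a + k , b)) (maximal-run a k m i< (λ i+1< → stop (proj₂ (R≐ _)
    ((≤-trans (m≤m+n a k) (n≤1+n _) , i+1<) , colOk)))))
  where
  colOk = proj₂ (proj₁ (R≐ _) (run k ≤-refl))
  i< = proj₂ (proj₁ (proj₁ (R≐ _) (run k ≤-refl)))

row-rem : ∀ {R a b m n} → R ≐ Box a b (suc m) (suc n) →
          Rem R (a , b) (a , b + n) ≐ Box (suc a) b m (suc n)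
row-rem {R} {a} {b} {m} {n} R≐ (i , j) = to , from
  where
  to : Rem R (a , b) (a , b + n) (i , j) → Box (suc a) b m (suc n) (i , j)
  to (r , out) with proj₁ (R≐ _) r
  ... | ((a≤i , i<) , (b≤j , j<)) with m≤n⇒m<n∨m≡n a≤i
  ...   | inj₁ a<i  = (a<i , subst (i <_) (+-suc a m) i<) , (b≤j , j<)
  ...   | inj₂ refl = ⊥-elim (out ((a≤i , ≤-refl) , (b≤j , ≤-pred (subst (j <_) (+-suc b n) j<))))
  from : Box (suc a) b m (suc n) (i , j) → Rem R (a , b) (a , b + n) (i , j)
  from ((a<i , i<) , col) =
    proj₂ (R≐ _) ((<⇒≤ a<i , subst (i <_) (sym (+-suc a m)) i<) , col) ,
    (λ { ((_ , i≤a) , _) → <⇒≱ a<i i≤a })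

col-rem : ∀ {R a b m n} → R ≐ Box a b (suc m) (suc n) →
          Rem R (a , b) (a + m , b) ≐ Box a (suc b) (suc m) n
col-rem {R} {a} {b} {m} {n} R≐ (i , j) = to , from
  where
  to : Rem R (a , b) (a + m , b) (i , j) → Box a (suc b) (suc m) n (i , j)
  to (r , out) with proj₁ (R≐ _) r
  ... | ((a≤i , i<) , (b≤j , j<)) with m≤n⇒m<n∨m≡n b≤j
  ...   | inj₁ b<j  = (a≤i , i<) , (b<j , subst (j <_) (+-suc b n) j<)
  ...   | inj₂ refl = ⊥-elim (out ((a≤i , ≤-pred (subst (i <_) (+-suc a m) i<)) , (b≤j , ≤-refl)))
  from : Box a (suc b) (suc m) n (i , j) → Rem R (a , b) (a + m , b) (i , j)
  from (row , (b<j , j<)) =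
    proj₂ (R≐ _) (row , (<⇒≤ b<j , subst (j <_) (sym (+-suc b n)) j<)) ,
    (λ { (_ , (_ , j≤b)) → <⇒≱ b<j j≤b })

≋-refl : ∀ {T} → T ≋ T
≋-refl t = (λ x → x) , (λ x → x)

≋-sym : ∀ {T U} → T ≋ U → U ≋ T
≋-sym T≋U t = proj₂ (T≋U t) , proj₁ (T≋U t)

≋-trans : ∀ {T U V} → T ≋ U → U ≋ V → T ≋ V
≋-trans T≋U U≋V t =
  (λ x → proj₁ (U≋V t) (proj₁ (T≋U t) x)) , (λ x → proj₂ (T≋U t) (proj₂ (U≋V t) x))

≋-cons : ∀ {x T U} → T ≋ U → (x ∷ T) ≋ (x ∷ U)
≋-cons T≋U t = extend (proj₁ (T≋U t)) , extend (proj₂ (T≋U t))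
  where
  extend : ∀ {A B : List Seg} {x} → (t ∈ A → t ∈ B) → t ∈ x ∷ A → t ∈ x ∷ B
  extend _   (here eq) = here eq
  extend A⊆B (there p) = there (A⊆B p)

≋-uncons : ∀ {x T U} → x ∉ T → x ∉ U → (x ∷ T) ≋ (x ∷ U) → T ≋ U
≋-uncons {x} x∉T x∉U xT≋xU t = restrict x∉T (proj₁ (xT≋xU t)) , restrict x∉U (proj₂ (xT≋xU t))
  where
  restrict : ∀ {A B : List Seg} → x ∉ A → (t ∈ x ∷ A → t ∈ x ∷ B) → t ∈ A → t ∈ B
  restrict x∉A sub p with sub (there p)
  ... | here refl = ⊥-elim (x∉A p)
  ... | there q   = q

unique-⊆-length : ∀ {A : Set} {xs ys : List A} → Unique xs → (∀ {t} → t ∈ xs → t ∈ ys) →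
                  length xs ≤ length ys
unique-⊆-length {xs = []}     _                 _   = z≤n
unique-⊆-length {xs = x ∷ xs} {ys} (x∉xs AllPairs.∷ uxs) sub =
  subst (suc (length xs) ≤_) (sym (length-removeAt′ ys (Any.index x∈ys)))
    (s≤s (unique-⊆-length uxs (λ t∈xs →
      ∈-─ x∈ys (sub (there t∈xs)) (λ t≡x → All.lookup x∉xs t∈xs (sym t≡x)))))
  where
  x∈ys : x ∈ ys
  x∈ys = sub (here refl)
  ∈-─ : ∀ {zs t} (p : x ∈ zs) → t ∈ zs → t ≢ x → t ∈ (zs Any.─ p)
  ∈-─ (here refl) (here refl) t≢x = ⊥-elim (t≢x refl)
  ∈-─ (here refl) (there q)   _   = q
  ∈-─ (there p)   (here refl) _   = here refl
  ∈-─ (there p)   (there q)   t≢x = there (∈-─ p q t≢x)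

Family : Cells → Set
Family U = (c : Cell) → U c → List Seg

Consistent : (U : Cells) → Family U → Set
Consistent U f = ∀ c d uc ud → Conn U c d → f c uc ≋ f d ud

Union : (U : Cells) → Family U → List Seg → Set
Union U f T' = ∀ t → (t ∈ T' → Σ Cell λ c → Σ (U c) λ uc → t ∈ f c uc)
                   × (∀ c uc → t ∈ f c uc → t ∈ T')

union-empty : ∀ {U f T'} → Union U f T' → (∀ c → ¬ U c) → T' ≡ []
union-empty {T' = []}     _   _    = refl
union-empty {T' = x ∷ T'} un none with proj₁ (un x) (here refl)
... | c , uc , _ = ⊥-elim (none c uc)

union-connected : ∀ {U f T'} → Consistent U f → Union U f T' →
                  ∀ c uc → (∀ d → U d → Conn U c d) → T' ≋ f c uc
union-connected {f = f} {T'} cons un c uc conn t = into , (λ r → proj₂ (un t) c uc r)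
  where
  into : t ∈ T' → t ∈ f c uc
  into r with proj₁ (un t) r
  ... | d , ud , r' = proj₂ (cons c d uc ud (conn d ud) t) r'

place-last : ∀ {R s e} → NW R s → MaxSpot R s e → (∀ c → ¬ Rem R s e c) →
             Tiles R (seg s e ∷ [])
place-last nw spot none =
  step _ _ nw spot (λ _ _ → []) (λ c u → ⊥-elim (none c u)) (λ _ _ _ _ _ → ≋-refl)
       (λ t → (λ ()) , (λ _ _ x → x)) AllPairs.[]

place-box : ∀ {R s e a b m n T'} → NW R s → MaxSpot R s e →
            Rem R s e ≐ Box a b (suc m) (suc n) →
            (∀ {R'} → R' ≐ Box a b (suc m) (suc n) → Tiles R' T') → Unique T' →
            Tiles R (seg s e ∷ T')
place-box {a = a} {b} {m} {n} {T'} nw spot rem≐ tiles uq =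
  step _ _ nw spot (λ _ _ → T') (λ c u → tiles (component-of-box rem≐ u)) (λ _ _ _ _ _ → ≋-refl)
       (λ t → (λ x → (a , b) , proj₂ (rem≐ _) (box-corner a b m n) , x) , (λ _ _ x → x)) uq

-- They correspond to the
-- lattice paths from (m , n) to (0 , 0).
data Canonical : ℕ → ℕ → ℕ → ℕ → List Seg → Set where
  single : ∀ {a b} → Canonical a b 0 0 (topRow a b 0 ∷ [])
  byRow  : ∀ {a b m n T} → Canonical (suc a) b m n T →
           Canonical a b (suc m) n (topRow a b n ∷ T)
  byCol  : ∀ {a b m n T} → Canonical a (suc b) m n T →
           Canonical a b m (suc n) (leftCol a b m ∷ T)

canonical-exists : ∀ a b m n → Σ (List Seg) (Canonical a b m n)
canonical-exists a b zero    zero    = _ , single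
canonical-exists a b (suc m) n       = _ , byRow (proj₂ (canonical-exists (suc a) b m n))
canonical-exists a b zero    (suc n) = _ , byCol (proj₂ (canonical-exists a (suc b) zero n))

canonical-length : ∀ {a b m n T} → Canonical a b m n T → length T ≡ suc (m + n)
canonical-length single            = refl
canonical-length (byRow c)         = cong suc (canonical-length c)
canonical-length (byCol {m = m} {n} c) =
  cong suc (trans (canonical-length c) (sym (+-suc m n)))

canonical-starts : ∀ {a b m n T t} → Canonical a b m n T → t ∈ T →
                   a ≤ row (Seg.start t) × b ≤ col (Seg.start t)
canonical-starts single    (here refl) = ≤-refl , ≤-refl
canonical-starts (byRow c) (here refl) = ≤-refl , ≤-refl
canonical-starts (byCol c) (here refl) = ≤-refl , ≤-refl
canonical-starts (byRow c) (there p)   with canonical-starts c p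
... | a<i , b≤j = <⇒≤ a<i , b≤j
canonical-starts (byCol c) (there p)   with canonical-starts c p
... | a≤i , b<j = a≤i , <⇒≤ b<j

fresh-below : ∀ {a b m n T e} → Canonical (suc a) b m n T → seg (a , b) e ∉ T
fresh-below c p = <-irrefl refl (proj₁ (canonical-starts c p))

fresh-right : ∀ {a b m n T e} → Canonical a (suc b) m n T → seg (a , b) e ∉ T
fresh-right c p = <-irrefl refl (proj₂ (canonical-starts c p))

canonical-unique : ∀ {a b m n T} → Canonical a b m n T → Unique T
canonical-unique single    = All.[] AllPairs.∷ AllPairs.[]
canonical-unique (byRow c) =
  All.tabulate (λ { p refl → fresh-below c p }) AllPairs.∷ canonical-unique c
canonical-unique (byCol c) =
  All.tabulate (λ { p refl → fresh-right c p }) AllPairs.∷ canonical-unique c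

canonical-tiles : ∀ {a b m n T R} → Canonical a b m n T → R ≐ Box a b (suc m) (suc n) → Tiles R T
canonical-tiles single    R≐ =
  place-last (box-nw R≐) (row-spot R≐) (λ c u → box-no-rows (proj₁ (row-rem R≐ c) u))
canonical-tiles (byRow c) R≐ =
  place-box (box-nw R≐) (row-spot R≐) (row-rem R≐) (canonical-tiles c) (canonical-unique c)
canonical-tiles (byCol c) R≐ =
  place-box (box-nw R≐) (col-spot R≐) (col-rem R≐) (canonical-tiles c) (canonical-unique c)

canonical-≋ : ∀ {a b m n T U} → Canonical a b m n T → Canonical a b m n U → T ≋ U → T ≡ U
canonical-≋ single    single    _    = refl
canonical-≋ (byRow c) (byRow d) T≋U =
  cong (_ ∷_) (canonical-≋ c d (≋-uncons (fresh-below c) (fresh-below d) T≋U))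
canonical-≋ (byCol c) (byCol d) T≋U =
  cong (_ ∷_) (canonical-≋ c d (≋-uncons (fresh-right c) (fresh-right d) T≋U))
canonical-≋ (byRow c) (byCol d) T≋U with proj₁ (T≋U _) (here refl)
... | here row≡col = ⊥-elim (topRow≢leftCol row≡col)
... | there p      = ⊥-elim (fresh-right d p)
canonical-≋ (byCol c) (byRow d) T≋U = sym (canonical-≋ (byRow d) (byCol c) (≋-sym T≋U))

canonicals : ℕ → ℕ → ℕ → ℕ → List (List Seg)
rowFirst   : ℕ → ℕ → ℕ → ℕ → List (List Seg)
colFirst   : ℕ → ℕ → ℕ → ℕ → List (List Seg)

canonicals a b zero    zero    = (topRow a b 0 ∷ []) ∷ []
canonicals a b (suc m) zero    = rowFirst a b m zero
canonicals a b zero    (suc n) = colFirst a b zero n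
canonicals a b (suc m) (suc n) = rowFirst a b m (suc n) ++ colFirst a b (suc m) n

rowFirst a b m n = map (topRow a b n ∷_) (canonicals (suc a) b m n)
colFirst a b m n = map (leftCol a b m ∷_) (canonicals a (suc b) m n)

canonicals-sound : ∀ {a b m n T} → T ∈ canonicals a b m n → Canonical a b m n T
rowFirst-sound   : ∀ {a b m n T} → T ∈ rowFirst a b m n → Canonical a b (suc m) n T
colFirst-sound   : ∀ {a b m n T} → T ∈ colFirst a b m n → Canonical a b m (suc n) T

canonicals-sound {m = zero}  {zero}  (here refl) = single
canonicals-sound {m = suc m} {zero}  p = rowFirst-sound p
canonicals-sound {m = zero}  {suc n} p = colFirst-sound p
canonicals-sound {a} {b} {suc m} {suc n} p with ∈-++⁻ (rowFirst a b m (suc n)) p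
... | inj₁ q = rowFirst-sound q
... | inj₂ q = colFirst-sound q

rowFirst-sound p with ∈-map⁻ _ p
... | _ , q , refl = byRow (canonicals-sound q)
colFirst-sound p with ∈-map⁻ _ p
... | _ , q , refl = byCol (canonicals-sound q)

canonicals-complete : ∀ {a b m n T} → Canonical a b m n T → T ∈ canonicals a b m n
canonicals-complete single                  = here refl
canonicals-complete (byRow {n = zero}  c)   = ∈-map⁺ _ (canonicals-complete c)
canonicals-complete (byRow {n = suc n} c)   = ∈-++⁺ˡ (∈-map⁺ _ (canonicals-complete c))
canonicals-complete (byCol {m = zero}  c)   = ∈-map⁺ _ (canonicals-complete c)
canonicals-complete (byCol {m = suc m} c)   = ∈-++⁺ʳ _ (∈-map⁺ _ (canonicals-complete c))

-- Lattice paths are counted by Pascal's rule.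
canonicals-count : ∀ a b m n → length (canonicals a b m n) ≡ (m + n) C m
canonicals-count a b zero    zero    = refl
canonicals-count a b (suc m) zero    = begin
  length (rowFirst a b m 0)          ≡⟨ length-map _ (canonicals (suc a) b m 0) ⟩
  length (canonicals (suc a) b m 0)  ≡⟨ canonicals-count (suc a) b m 0 ⟩
  (m + 0) C m                        ≡⟨ diagonal m ⟩
  1                                  ≡⟨ diagonal (suc m) ⟨
  (suc m + 0) C suc m                ∎
  where
  open ≡-Reasoning
  diagonal : ∀ k → (k + 0) C k ≡ 1
  diagonal k = trans (cong (_C k) (+-identityʳ k)) (nCn≡1 k)
canonicals-count a b zero    (suc n) =
  trans (length-map _ (canonicals a (suc b) 0 n)) (canonicals-count a (suc b) 0 n)
canonicals-count a b (suc m) (suc n) = begin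
  length (rowFirst a b m (suc n) ++ colFirst a b (suc m) n)
    ≡⟨ length-++ (rowFirst a b m (suc n)) ⟩
  length (rowFirst a b m (suc n)) + length (colFirst a b (suc m) n)
    ≡⟨ cong₂ _+_ (length-map _ (canonicals (suc a) b m (suc n)))
                 (length-map _ (canonicals a (suc b) (suc m) n)) ⟩
  length (canonicals (suc a) b m (suc n)) + length (canonicals a (suc b) (suc m) n)
    ≡⟨ cong₂ _+_ (canonicals-count (suc a) b m (suc n)) (canonicals-count a (suc b) (suc m) n) ⟩
  (m + suc n) C m + suc (m + n) C suc m
    ≡⟨ cong (λ k → k C m + suc (m + n) C suc m) (+-suc m n) ⟩
  suc (m + n) C m + suc (m + n) C suc m
    ≡⟨ nCk+nC[k+1]≡[n+1]C[k+1] (suc (m + n)) m ⟩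
  suc (suc (m + n)) C suc m
    ≡⟨ cong (λ k → suc k C suc m) (+-suc m n) ⟨
  (suc m + suc n) C suc m
    ∎
  where open ≡-Reasoning

-- Different lattice paths give different lists: the first spotlights of
-- the two halves of the list differ.
canonicals-unique : ∀ a b m n → Unique (canonicals a b m n)
canonicals-unique a b zero    zero    = All.[] AllPairs.∷ AllPairs.[]
canonicals-unique a b (suc m) zero    =
  Unique.map⁺ ∷-injectiveʳ (canonicals-unique (suc a) b m zero)
canonicals-unique a b zero    (suc n) =
  Unique.map⁺ ∷-injectiveʳ (canonicals-unique a (suc b) zero n)
canonicals-unique a b (suc m) (suc n) =
  Unique.++⁺ (Unique.map⁺ ∷-injectiveʳ (canonicals-unique (suc a) b m (suc n)))
             (Unique.map⁺ ∷-injectiveʳ (canonicals-unique a (suc b) (suc m) n))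
             (λ (p , q) → disjoint p q)
  where
  disjoint : ∀ {T} → T ∈ rowFirst a b m (suc n) → T ∈ colFirst a b (suc m) n → ⊥
  disjoint p q with ∈-map⁻ _ p | ∈-map⁻ _ q
  ... | _ , _ , refl | _ , _ , eq = topRow≢leftCol (∷-injectiveˡ eq)

canonicals-distinct : ∀ {a b m n L} → All (Canonical a b m n) L → Unique L →
                      AllPairs (λ T U → ¬ (T ≋ U)) L
canonicals-distinct All.[]         AllPairs.[]        = AllPairs.[]
canonicals-distinct (c All.∷ cs) (T∉L AllPairs.∷ uL) =
  All.zipWith (λ (d , T≢U) T≋U → T≢U (canonical-≋ c d T≋U)) (cs , T∉L)
    AllPairs.∷ canonicals-distinct cs uL

Capped : List Seg → ℕ → (List Seg → Set) → Set
Capped T k P = length T ≤ k × (length T ≡ k → Σ (List Seg) λ V → P V × T ≋ V)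

capped-≋ : ∀ {T U k P} → Unique T → T ≋ U → Capped U k P → Capped T k P
capped-≋ {T} {U} {k} {P} uT T≋U (U≤k , extremal) = ≤-trans T≤U U≤k , T-extremal
  where
  T≤U : length T ≤ length U
  T≤U = unique-⊆-length uT (proj₁ (T≋U _))
  T-extremal : length T ≡ k → Σ (List Seg) λ V → P V × T ≋ V
  T-extremal T≡k with extremal (≤-antisym U≤k (subst (_≤ length U) T≡k T≤U))
  ... | V , pV , U≋V = V , pV , ≋-trans T≋U U≋V

capped-∷ : ∀ {x T k} {P Q : List Seg → Set} → (∀ {V} → P V → Q (x ∷ V)) →
           Capped T k P → Capped (x ∷ T) (suc k) Q
capped-∷ {x} {T} {k} {P} {Q} P⇒Q (T≤k , extremal) = s≤s T≤k , xT-extremal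
  where
  xT-extremal : suc (length T) ≡ suc k → Σ (List Seg) λ V → Q V × (x ∷ T) ≋ V
  xT-extremal eq with extremal (suc-injective eq)
  ... | V , pV , T≋V = x ∷ V , P⇒Q pV , ≋-cons T≋V

-- The statement proved by induction on tilings, for the tilings of the components.
CappedFamily : (U : Cells) → Family U → Set
CappedFamily U f = ∀ c uc {a b m n} → Component U c ≐ Box a b (suc m) (suc n) →
                   Capped (f c uc) (suc (m + n)) (Canonical a b m n)

-- If a step leaves a nonempty box, the rest of the tiling is the tiling of
-- that box's single component, hence capped.
remainder-capped : ∀ {U f T' a b m n} → U ≐ Box a b (suc m) (suc n) → CappedFamily U f →
                   Consistent U f → Union U f T' → Unique T' →
                   Capped T' (suc (m + n)) (Canonical a b m n)
remainder-capped {a = a} {b} {m} {n} U≐ capped cons un uq =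
  capped-≋ uq (union-connected cons un (a , b) u (λ d ud → ≐box-connected U≐ u ud))
              (capped (a , b) u (component-of-box U≐ u))
  where
  u = proj₂ (U≐ _) (box-corner a b m n)

row-case : ∀ {R a b m n T'} → R ≐ Box a b (suc m) (suc n) →
           (f : Family (Rem R (a , b) (a , b + n))) → CappedFamily _ f → Consistent _ f →
           Union _ f T' → Unique T' → Capped (topRow a b n ∷ T') (suc (m + n)) (Canonical a b m n)
row-case {m = zero} {n} R≐ f capped cons un uq
  with union-empty un (λ c u → box-no-rows (proj₁ (row-rem R≐ c) u))
row-case {m = zero} {zero}  R≐ f capped cons un uq | refl = s≤s z≤n , λ _ → _ , single , ≋-refl
row-case {m = zero} {suc n} R≐ f capped cons un uq | refl = s≤s z≤n , λ ()
row-case {m = suc m} R≐ f capped cons un uq =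
  capped-∷ byRow (remainder-capped (row-rem R≐) capped cons un uq)

col-case : ∀ {R a b m n T'} → R ≐ Box a b (suc m) (suc n) →
           (f : Family (Rem R (a , b) (a + m , b))) → CappedFamily _ f → Consistent _ f →
           Union _ f T' → Unique T' → Capped (leftCol a b m ∷ T') (suc (m + n)) (Canonical a b m n)
col-case {m = m} {zero} R≐ f capped cons un uq
  with union-empty un (λ c u → box-no-cols (proj₁ (col-rem R≐ c) u))
col-case {a = a} {b} {zero} {zero} R≐ f capped cons un uq | refl =
  s≤s z≤n , λ _ → _ , single , subst (λ x → (x ∷ []) ≋ (topRow a b 0 ∷ [])) (sym square) ≋-refl
  where
  square : leftCol a b 0 ≡ topRow a b 0
  square = cong (seg (a , b)) (cong₂ _,_ (+-identityʳ a) (sym (+-identityʳ b)))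
col-case {m = suc m} {zero} R≐ f capped cons un uq | refl = s≤s z≤n , λ ()
col-case {a = a} {b} {m} {suc n} {T'} R≐ f capped cons un uq =
  subst (λ k → Capped (leftCol a b m ∷ T') (suc k) (Canonical a b m (suc n))) (sym (+-suc m n))
    (capped-∷ byCol (remainder-capped (col-rem R≐) capped cons un uq))

classify : ∀ {R T a b m n} → Tiles R T → R ≐ Box a b (suc m) (suc n) →
           Capped T (suc (m + n)) (Canonical a b m n)
classify {a = a} {b} {m} {n} (empty none) R≐ = ⊥-elim (none _ (proj₂ (R≐ _) (box-corner a b m n)))
classify (step s e nw spot f tiles cons un uq) R≐ with box-nw-unique R≐ nw
... | refl with box-spotlight R≐ spot
...   | inj₁ refl = row-case R≐ f (λ c u → classify (tiles c u)) cons un uq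
...   | inj₂ refl = col-case R≐ f (λ c u → classify (tiles c u)) cons un uq

canonical-maximal : ∀ {m n T} → Canonical 0 0 m n T → MaxTiling (suc m) (suc n) T
canonical-maximal {m} {n} c =
  canonical-tiles c (rect≐box (suc m) (suc n)) ,
  λ T' tiles → subst (length T' ≤_) (sym (canonical-length c))
                     (proj₁ (classify tiles (rect≐box (suc m) (suc n))))

maximal-canonical : ∀ {m n T} → MaxTiling (suc m) (suc n) T → Any (T ≋_) (canonicals 0 0 m n)
maximal-canonical {m} {n} {T} (tiles , maximal) =
  listed (proj₂ capped (≤-antisym (proj₁ capped) T≥))
  where
  capped : Capped T (suc (m + n)) (Canonical 0 0 m n)
  capped = classify tiles (rect≐box (suc m) (suc n))
  witness : Σ (List Seg) (Canonical 0 0 m n)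
  witness = canonical-exists 0 0 m n
  T≥ : suc (m + n) ≤ length T
  T≥ = subst (_≤ length T) (canonical-length (proj₂ witness))
             (maximal _ (canonical-tiles (proj₂ witness) (rect≐box (suc m) (suc n))))
  listed : (Σ (List Seg) λ V → Canonical 0 0 m n V × T ≋ V) → Any (T ≋_) (canonicals 0 0 m n)
  listed (V , cV , T≋V) = Any.map (λ { refl → T≋V }) (canonicals-complete cV)

theorem3p5 : (m n : ℕ) → 1 ≤ m → 1 ≤ n →
    Σ (List (List Seg)) λ L →
        length L ≡ (m + n ∸ 2) C (m ∸ 1)
      × All (MaxTiling m n) L
      × AllPairs (λ T T' → ¬ (T ≋ T')) L
      × ((T : List Seg) → MaxTiling m n T → Any (T ≋_) L)
theorem3p5 (suc m) (suc n) (s≤s z≤n) (s≤s z≤n) =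
  canonicals 0 0 m n ,
  trans (canonicals-count 0 0 m n) (cong (λ k → (k ∸ 1) C m) (sym (+-suc m n))) ,
  All.tabulate (λ p → canonical-maximal (sound p)) ,
  canonicals-distinct (All.tabulate sound) (canonicals-unique 0 0 m n) ,
  λ T → maximal-canonical
  where
  sound : ∀ {T} → T ∈ canonicals 0 0 m n → Canonical 0 0 m n T
  sound = canonicals-sound
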